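{- If $\mathsf{P}^{dy}=\mathsf{NP}^{dy}$, then $\mathsf{PH}^{dy}=\mathsf{P}^{dy}$.
   Context: Dynamic problems. A dynamic problem is a pair $\mathcal{D}=(\mathcal{P},\mathcal{G})$ where $\mathcal{P}$ maps bit-strings (instances) to answers ($\{0,1\}$ for decision problems) and $\mathcal{G}_n$ is a directed graph on $\{0,1\}^n$ whose edges are allowed instance-updates; $\mathcal{D}_n$ is the restriction to $n$-bit instances; an instance-sequence is a directed path $(I_0,\dots,I_k)$ in $\mathcal{G}_n$. Standing assumption: instance-updates are encodable in $\Theta(\log n)$ bits. The complement of a decision dynamic problem has the same update graphs and negated answers. Bit-probe algorithms. $\mathcal{A}_n$ operates on a bit array; at step $0$ it receives $I_0$ and initializes memory by an arbitrary function of $I_0$ (uncharged); at step $t\ge1$ it receives $(I_{t-1},I_t)$ (possibly with extra input) and runs a fixed decision tree of memory-bit reads (branching) and writes; output is read from a designated region. Update time = tree depth; space = number of memory bits. $\mathcal{A}$ solves decision problem $\mathcal{D}$ if on every instance-sequence of length $\mathrm{poly}(n)$ its output at step $t$ is $\mathcal{D}(I_t)$. $\mathsf{P}^{dy}$: decision problems solvable with update time $O(\mathrm{polylog}\,n)$ and space $O(\mathrm{poly}\,n)$. Verifiers. $\mathcal{V}_n$ gets $I_0$ at step $0$ and outputs $(x_0,y_0)$; at step $t\ge1$ gets $((I_{t-1},I_t),\pi_t)$, $\pi_t\in\{0,1\}^{\mathrm{polylog}\,n}$, outputs $(x_t,y_t)$, $x_t\in\{0,1\}$, $y_t\in\{0,1\}^{\mathrm{polylog}\,n}$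 read as integer reward. A proof-sequence is reward-maximizing if each $\pi_t$ maximizes $y_t$ given the history. $\mathcal{D}\in\mathsf{NP}^{dy}$ iff a verifier-family with update time $O(\mathrm{polylog}\,n)$ and space $O(\mathrm{poly}\,n)$ satisfies: (1) for every proof-sequence, $x_t=0$ whenever $\mathcal{D}(I_t)=0$; (2) for reward-maximizing proof-sequences, $x_t=1$ whenever $\mathcal{D}(I_t)=1$. $\mathsf{coNP}^{dy}$: same with $0$ and $1$ exchanged in both $\mathcal{D}(I_t)$ and $x_t$ (equivalently, complements of $\mathsf{NP}^{dy}$ problems). Oracles. An algorithm/verifier may use an oracle for a dynamic problem $\mathcal{D}'$ on slice $\mathcal{D}'_m$, $m\le\mathrm{BlowUp}(n)$: it feeds an initial instance then instance-updates of $\mathcal{D}'_m$ and reads the answer of the current oracle instance after each call; calls cost no time and oracle memory is not counted. $(\mathcal{C}_1)^{\mathcal{C}_2}$: problems meeting the definition of $\mathcal{C}_1$ when an oracle-family for some problem in $\mathcal{C}_2$ with blow-up $O(\mathrm{poly}\,n)$ may be used. $\Sigma_1=\mathsf{NP}^{dy}$, $\Pi_1=\mathsf{coNP}^{dy}$, $\Sigma_i=(\mathsf{NP}^{dy})^{\Sigma_{i-1}}$, $\Pi_i=(\mathsf{coNP}^{dy})^{\Sigma_{i-1}}$ for $i>1$, and $\mathsf{PH}^{dy}=\bigcup_{i\ge1}(\Sigma_i\cup\Pi_i)$. -}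

module Defs where

open import Data.Nat using (ℕ; zero; suc; _+_; _*_; _^_; _≤_)
open import Data.Nat.Logarithm using (⌊log₂_⌋)
open import Data.Bool using (Bool; true; false; not)
open import Data.Fin using (Fin)
open import Data.Vec using (Vec; []; lookup; map; foldl)
open import Data.Maybe using (Maybe; just; nothing)
open import Data.Product using (Σ; Σ-syntax; ∃; ∃-syntax; _×_; _,_)
open import Data.Sum using (_⊎_)
open import Data.Unit using (⊤; tt)
open import Data.Empty using (⊥)
open import Relation.Binary.PropositionalEquality using (_≡_)

IsPoly : (ℕ → ℕ) → Set
IsPoly f = Σ[ c ∈ ℕ ] Σ[ k ∈ ℕ ] (∀ n → f n ≤ c * (suc n) ^ k)

IsPolylog : (ℕ → ℕ) → Set
IsPolylog f = Σ[ c ∈ ℕ ] Σ[ k ∈ ℕ ] (∀ n → f n ≤ c * (suc ⌊log₂ n ⌋) ^ k)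

IsThetaLog : (ℕ → ℕ) → Set
IsThetaLog f = Σ[ c ∈ ℕ ] (∀ n → (f n ≤ c * suc ⌊log₂ n ⌋) × (⌊log₂ n ⌋ ≤ c * f n))

Bits : ℕ → Set
Bits n = Vec Bool n

-- The update graph G_n on {0,1}^n is given
-- through the (standing-assumption) encoding of instance-updates by
-- ulen n = Θ(log n) bits: there is an edge I → I' in G_n iff
-- upd n I u ≡ just I' for some update code u.
record DynProblem : Set where
  field
    ans      : (n : ℕ) → Bits n → Bool
    ulen     : ℕ → ℕ
    upd      : (n : ℕ) → Bits n → Bits (ulen n) → Maybe (Bits n)
    ulen-log : IsThetaLog ulen
open DynProblem public

complement : DynProblem → DynProblem
complement D = record
  { ans = λ n I → not (ans D n I) ; ulen = ulen D ; upd = upd D ; ulen-log = ulen-log D }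

-- Oracles ("nothing" = no oracle)

OState : Maybe DynProblem → ℕ → Set
OState nothing  m = ⊤
OState (just D) m = Bits m

OCode : Maybe DynProblem → ℕ → Set
OCode nothing  m = ⊥
OCode (just D) m = Bits (ulen D m)

-- feed an instance-update to the oracle; get new oracle instance and its answer
-- (nothing if the fed update is not an edge of the oracle's update graph)
ostep : (o : Maybe DynProblem) (m : ℕ) → OState o m → OCode o m → Maybe (OState o m × Bool)
ostep nothing  m s ()
ostep (just D) m J u with upd D m J u
... | just J' = just (J' , ans D m J')
... | nothing = nothing

-- Bit-probe decision trees over a memory of s bits, with oracle calls of code type C

data Tree (s : ℕ) (C : Set) : Set where
  leaf : Tree s C
  rd   : Fin s → Tree s C → Tree s C → Tree s C
  wr   : Fin s → Bool → Tree s C → Tree s C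
  call : C → Tree s C → Tree s C → Tree s C

depth : ∀ {s C} → Tree s C → ℕ
depth leaf         = 0
depth (rd i t f)   = suc (Data.Nat._⊔_ (depth t) (depth f))
depth (wr i b t)   = suc (depth t)
depth (call u t f) = suc (Data.Nat._⊔_ (depth t) (depth f))

-- Machines (algorithms / verifiers), for one slice n.
--   o : oracle, u : update-code length, e : extra input (proof) length,
--   r : reward length.

record Machine (o : Maybe DynProblem) (n u e r : ℕ) : Set where
  field
    mem   : ℕ
    slice : ℕ
    init  : Bits n → Vec Bool mem × OState o slice
    tree  : Bits u → Bits e → Tree mem (OCode o slice)
    outx  : Fin mem
    outy  : Vec (Fin mem) r
open Machine public

Cfg : ∀ {o n u e r} → Machine o n u e r → Set
Cfg {o} M = Vec Bool (mem M) × OState o (slice M)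

exec : ∀ {o s m} → Tree s (OCode o m) → Vec Bool s × OState o m → Maybe (Vec Bool s × OState o m)
exec leaf (μ , J) = just (μ , J)
exec (rd i t f) (μ , J) with lookup μ i
... | true  = exec t (μ , J)
... | false = exec f (μ , J)
exec (wr i b t) (μ , J) = exec t (Data.Vec._[_]≔_ μ i b , J)
exec {o} {m = m} (call u t f) (μ , J) with ostep o m J u
... | nothing          = nothing
... | just (J' , true)  = exec t (μ , J')
... | just (J' , false) = exec f (μ , J')

stepM : ∀ {o n u e r} (M : Machine o n u e r) → Bits u → Bits e → Cfg M → Maybe (Cfg M)
stepM M c π κ = exec (tree M c π) κ

outX : ∀ {o n u e r} (M : Machine o n u e r) → Cfg M → Bool
outX M (μ , _) = lookup μ (outx M)

bitsToℕ : ∀ {k} → Vec Bool k → ℕ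
bitsToℕ = foldl _ (λ acc b → 2 * acc + (if b then 1 else 0)) 0
  where open import Data.Bool using (if_then_else_)

outY : ∀ {o n u e r} (M : Machine o n u e r) → Cfg M → ℕ
outY M (μ , _) = bitsToℕ (map (lookup μ) (outy M))

-- Correctness, for all instance-sequences with at most k further updates

AlgOK : ∀ {o n r} (D : DynProblem) (M : Machine o n (ulen D n) 0 r) →
        Bits n → Cfg M → ℕ → Set
AlgOK {n = n} D M I κ zero    = outX M κ ≡ ans D n I
AlgOK {n = n} D M I κ (suc k) = (outX M κ ≡ ans D n I) ×
  (∀ c I' → upd D n I c ≡ just I' →
     Σ[ κ' ∈ Cfg M ] (stepM M c [] κ ≡ just κ') × AlgOK D M I' κ' k)

-- verifier condition (1), polarity b (b = true: NP, b = false: coNP):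
-- for every proof-sequence, x_t = not b whenever D(I_t) = not b
VSound : ∀ {o n e r} (b : Bool) (D : DynProblem) (M : Machine o n (ulen D n) e r) →
         Bits n → Cfg M → ℕ → Set
VSound {n = n} b D M I κ zero    = ans D n I ≡ not b → outX M κ ≡ not b
VSound {n = n} b D M I κ (suc k) = (ans D n I ≡ not b → outX M κ ≡ not b) ×
  (∀ c I' → upd D n I c ≡ just I' → ∀ π →
     Σ[ κ' ∈ Cfg M ] (stepM M c π κ ≡ just κ') × VSound b D M I' κ' k)

-- π maximizes the reward y_t given the history (= current configuration)
Maximizing : ∀ {o n u e r} (M : Machine o n u e r) → Cfg M → Bits u → Bits e → Set
Maximizing M κ c π = ∀ π' κ₁ κ₂ → stepM M c π κ ≡ just κ₁ → stepM M c π' κ ≡ just κ₂ →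
                     outY M κ₂ ≤ outY M κ₁

VComplete : ∀ {o n e r} (b : Bool) (D : DynProblem) (M : Machine o n (ulen D n) e r) →
            Bits n → Cfg M → ℕ → Set
VComplete {n = n} b D M I κ zero    = ans D n I ≡ b → outX M κ ≡ b
VComplete {n = n} b D M I κ (suc k) = (ans D n I ≡ b → outX M κ ≡ b) ×
  (∀ c I' → upd D n I c ≡ just I' → ∀ π κ' →
     stepM M c π κ ≡ just κ' → Maximizing M κ c π → VComplete b D M I' κ' k)

Resources : ∀ {o} {u e r : ℕ → ℕ} → ((n : ℕ) → Machine o n (u n) (e n) (r n)) → Set
Resources M =
  (Σ[ T ∈ (ℕ → ℕ) ] IsPolylog T × (∀ n c π → depth (tree (M n) c π) ≤ T n)) ×
  (Σ[ S ∈ (ℕ → ℕ) ] IsPoly S × (∀ n → mem (M n) ≤ S n)) ×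
  (Σ[ B ∈ (ℕ → ℕ) ] IsPoly B × (∀ n → slice (M n) ≤ B n))

InP : Maybe DynProblem → DynProblem → Set
InP o D = Σ[ M ∈ ((n : ℕ) → Machine o n (ulen D n) 0 0) ] Resources M ×
  (∀ p → IsPoly p → ∀ n (I : Bits n) → AlgOK D (M n) I (init (M n) I) (p n))

InVer : Bool → Maybe DynProblem → DynProblem → Set
InVer b o D =
  Σ[ e ∈ (ℕ → ℕ) ] Σ[ r ∈ (ℕ → ℕ) ] IsPolylog e × IsPolylog r ×
  Σ[ M ∈ ((n : ℕ) → Machine o n (ulen D n) (e n) (r n)) ] Resources M ×
  (∀ p → IsPoly p → ∀ n (I : Bits n) →
     VSound b D (M n) I (init (M n) I) (p n) × VComplete b D (M n) I (init (M n) I) (p n))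

Pdy : DynProblem → Set
Pdy = InP nothing

NPdy : DynProblem → Set
NPdy = InVer true nothing

-- SigmaL i = Σ_{i+1}, PiL i = Π_{i+1}
SigmaL : ℕ → DynProblem → Set
SigmaL zero    D = InVer true nothing D
SigmaL (suc i) D = Σ[ D' ∈ DynProblem ] SigmaL i D' × InVer true (just D') D

PiL : ℕ → DynProblem → Set
PiL zero    D = InVer false nothing D
PiL (suc i) D = Σ[ D' ∈ DynProblem ] SigmaL i D' × InVer false (just D') D

PHdy : DynProblem → Set
PHdy D = Σ[ i ∈ ℕ ] (SigmaL i D ⊎ PiL i D)

_≐_ : (DynProblem → Set) → (DynProblem → Set) → Set
C₁ ≐ C₂ = ∀ D → (C₁ D → C₂ D) × (C₂ D → C₁ D)

{-# OPTIONS --safe #-}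
-- Under P = NP also coNP ⊆ P: complementing a coNP verifier (by storing the
-- negation of its output bit) gives an NP verifier for the complement, which
-- then has a polylog-time algorithm, and complementing that algorithm again
-- gives one for the original problem.  A verifier at level i + 1 queries an
-- oracle from level i, which by induction has a P-algorithm; the verifier can
-- run that algorithm on a second memory region instead of calling the oracle.
-- Each call then costs polylog(poly n) = polylog n steps and the memory grows by
-- poly(poly n) = poly n bits, so the verifier becomes an oracle-free NP or coNP
-- verifier, and the problem is in P.
module Submission where

open import Defs
open import Data.Nat using (ℕ; zero; suc; _+_; _*_; _^_; _≤_; _<_; _⊔_; z≤n; s≤s)
open import Data.Nat.Properties
open import Data.Nat.Logarithm using (⌊log₂_⌋; ⌊log₂⌋-mono-≤; ⌊log₂[2^n]⌋≡n)
open import Data.Bool using (Bool; true; false; not; _xor_; if_then_else_)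
open import Data.Bool.Properties using (not-involutive; not-injective; not-distribʳ-xor)
open import Data.Fin using (Fin; zero; suc; _↑ˡ_; _↑ʳ_)
open import Data.Vec using (Vec; []; _∷_; lookup; map; _++_; _[_]≔_)
open import Data.Vec.Properties using (map-∘; map-cong; lookup-++ˡ; lookup-++ʳ; []≔-++-↑ˡ; []≔-++-↑ʳ)
open import Data.Maybe using (Maybe; just; nothing)
open import Data.Maybe.Properties using (just-injective)
open import Data.Product using (Σ-syntax; _×_; _,_; proj₁; proj₂)
open import Data.Sum using (inj₁; inj₂)
open import Data.Unit using (tt)
open import Data.Empty using (⊥)
open import Relation.Binary.PropositionalEquality
open import Function using (_∘_)
open import Algebra.Properties.CommutativeSemigroup *-commutativeSemigroup using (interchange)

-- IsPoly and IsPolylog are definitionally IsPolyIn (λ n → n) and IsPolyIn ⌊log₂_⌋.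
IsPolyIn : (ℕ → ℕ) → (ℕ → ℕ) → Set
IsPolyIn g f = Σ[ c ∈ ℕ ] Σ[ k ∈ ℕ ] (∀ n → f n ≤ c * suc (g n) ^ k)

module _ {g : ℕ → ℕ} where

  isPolyIn-mono : ∀ {f h} → (∀ n → f n ≤ h n) → IsPolyIn g h → IsPolyIn g f
  isPolyIn-mono f≤h (c , k , h≤) = c , k , λ n → ≤-trans (f≤h n) (h≤ n)

  isPolyIn-const : ∀ d → IsPolyIn g (λ _ → d)
  isPolyIn-const d = d , 0 , λ _ → ≤-reflexive (sym (*-identityʳ d))

  isPolyIn-suc : IsPolyIn g (λ n → suc (g n))
  isPolyIn-suc = 1 , 1 , λ n → ≤-reflexive (sym (trans (*-identityˡ _) (*-identityʳ _)))

  isPolyIn-+ : ∀ {f h} → IsPolyIn g f → IsPolyIn g h → IsPolyIn g (λ n → f n + h n)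
  isPolyIn-+ {f} {h} (c , k , f≤) (d , j , h≤) = c + d , k + j , bound
    where
    open ≤-Reasoning
    bound : ∀ n → f n + h n ≤ (c + d) * suc (g n) ^ (k + j)
    bound n = begin
      f n + h n                         ≤⟨ +-mono-≤ (f≤ n) (h≤ n) ⟩
      c * x ^ k + d * x ^ j             ≤⟨ +-mono-≤ (*-monoʳ-≤ c (^-monoʳ-≤ x (m≤m+n k j)))
                                                     (*-monoʳ-≤ d (^-monoʳ-≤ x (m≤n+m j k))) ⟩
      c * x ^ (k + j) + d * x ^ (k + j) ≡⟨ *-distribʳ-+ (x ^ (k + j)) c d ⟨
      (c + d) * x ^ (k + j)             ∎
      where x = suc (g n)

  isPolyIn-* : ∀ {f h} → IsPolyIn g f → IsPolyIn g h → IsPolyIn g (λ n → f n * h n)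
  isPolyIn-* {f} {h} (c , k , f≤) (d , j , h≤) = c * d , k + j , bound
    where
    open ≤-Reasoning
    bound : ∀ n → f n * h n ≤ (c * d) * suc (g n) ^ (k + j)
    bound n = begin
      f n * h n                 ≤⟨ *-mono-≤ (f≤ n) (h≤ n) ⟩
      (c * x ^ k) * (d * x ^ j) ≡⟨ interchange c (x ^ k) d (x ^ j) ⟩
      (c * d) * (x ^ k * x ^ j) ≡⟨ cong ((c * d) *_) (^-distribˡ-+-* x k j) ⟨
      (c * d) * x ^ (k + j)     ∎
      where x = suc (g n)

  isPolyIn-^ : ∀ {f} → IsPolyIn g f → ∀ j → IsPolyIn g (λ n → f n ^ j)
  isPolyIn-^ p zero    = isPolyIn-const 1
  isPolyIn-^ p (suc j) = isPolyIn-* p (isPolyIn-^ p j)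

isPolyIn-∘ : ∀ {g h f s B : ℕ → ℕ} → (∀ {a b} → a ≤ b → g a ≤ g b) →
             IsPolyIn g f → (∀ n → s n ≤ B n) → IsPolyIn h (λ n → suc (g (B n))) →
             IsPolyIn h (λ n → f (s n))
isPolyIn-∘ g-mono (c , k , f≤) s≤B sucgB =
  isPolyIn-mono (λ n → ≤-trans (f≤ _) (*-monoʳ-≤ c (^-monoˡ-≤ k (s≤s (g-mono (s≤B n))))))
                (isPolyIn-* (isPolyIn-const c) (isPolyIn-^ sucgB k))

n<2^[1+⌊log₂n⌋] : ∀ n → n < 2 ^ suc ⌊log₂ n ⌋
n<2^[1+⌊log₂n⌋] n = ≰⇒> λ 2^L≤n → n≮n L (begin-strict
    L                   <⟨ n<1+n L ⟩
    suc L               ≡⟨ ⌊log₂[2^n]⌋≡n (suc L) ⟨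
    ⌊log₂ 2 ^ suc L ⌋   ≤⟨ ⌊log₂⌋-mono-≤ 2^L≤n ⟩
    L                   ∎)
  where
  open ≤-Reasoning
  L = ⌊log₂ n ⌋

isPolylog-log : ∀ {B} → IsPoly B → IsPolylog (λ n → suc ⌊log₂ B n ⌋)
isPolylog-log {B} (c , k , B≤) =
  isPolyIn-mono bound (isPolyIn-+ (isPolyIn-const (suc C)) (isPolyIn-* isPolyIn-suc (isPolyIn-const k)))
  where
  open ≤-Reasoning
  C = suc ⌊log₂ c ⌋
  bound : ∀ n → suc ⌊log₂ B n ⌋ ≤ suc C + suc ⌊log₂ n ⌋ * k
  bound n = s≤s (begin
    ⌊log₂ B n ⌋                      ≤⟨ ⌊log₂⌋-mono-≤ B≤2^[C+L*k] ⟩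
    ⌊log₂ 2 ^ (C + L * k) ⌋          ≡⟨ ⌊log₂[2^n]⌋≡n (C + L * k) ⟩
    C + L * k                        ∎)
    where
    L = suc ⌊log₂ n ⌋
    B≤2^[C+L*k] : B n ≤ 2 ^ (C + L * k)
    B≤2^[C+L*k] = begin
      B n                 ≤⟨ B≤ n ⟩
      c * suc n ^ k       ≤⟨ *-mono-≤ (<⇒≤ (n<2^[1+⌊log₂n⌋] c)) (^-monoˡ-≤ k (n<2^[1+⌊log₂n⌋] n)) ⟩
      2 ^ C * (2 ^ L) ^ k ≡⟨ cong (2 ^ C *_) (^-*-assoc 2 L k) ⟩
      2 ^ C * 2 ^ (L * k) ≡⟨ ^-distribˡ-+-* 2 C (L * k) ⟨
      2 ^ (C + L * k)     ∎

isPoly-∘ : ∀ {f s B : ℕ → ℕ} → IsPoly f → (∀ n → s n ≤ B n) → IsPoly B → IsPoly (λ n → f (s n))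
isPoly-∘ pf s≤B pB = isPolyIn-∘ (λ a≤b → a≤b) pf s≤B (isPolyIn-+ (isPolyIn-const 1) pB)

isPolylog-∘ : ∀ {f s B : ℕ → ℕ} → IsPolylog f → (∀ n → s n ≤ B n) → IsPoly B → IsPolylog (λ n → f (s n))
isPolylog-∘ pf s≤B pB = isPolyIn-∘ ⌊log₂⌋-mono-≤ pf s≤B (isPolylog-log pB)

run : ∀ {s} → Tree s ⊥ → Vec Bool s → Vec Bool s
run leaf         μ = μ
run (rd i t f)   μ = if lookup μ i then run t μ else run f μ
run (wr i b t)   μ = run t (μ [ i ]≔ b)
run (call () t f) μ

exec-run : ∀ {s m} (t : Tree s ⊥) μ → exec {nothing} {s} {m} t (μ , tt) ≡ just (run t μ , tt)
exec-run leaf         μ = refl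
exec-run (rd i t f)   μ with lookup μ i
... | true  = exec-run t μ
... | false = exec-run f μ
exec-run (wr i b t)   μ = exec-run t (μ [ i ]≔ b)
exec-run (call () t f) μ

infixr 5 _⨾_

_⨾_ : ∀ {s C} → Tree s C → Tree s C → Tree s C
leaf         ⨾ g = g
rd i t f     ⨾ g = rd i (t ⨾ g) (f ⨾ g)
wr i b t     ⨾ g = wr i b (t ⨾ g)
call u t f   ⨾ g = call u (t ⨾ g) (f ⨾ g)

relocate : ∀ {s s' C} → (Fin s → Fin s') → Tree s C → Tree s' C
relocate ι leaf         = leaf
relocate ι (rd i t f)   = rd (ι i) (relocate ι t) (relocate ι f)
relocate ι (wr i b t)   = wr (ι i) b (relocate ι t)
relocate ι (call u t f) = call u (relocate ι t) (relocate ι f)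

run-⨾ : ∀ {s} (t g : Tree s ⊥) μ → run (t ⨾ g) μ ≡ run g (run t μ)
run-⨾ leaf         g μ = refl
run-⨾ (rd i t f)   g μ with lookup μ i
... | true  = run-⨾ t g μ
... | false = run-⨾ f g μ
run-⨾ (wr i b t)   g μ = run-⨾ t g (μ [ i ]≔ b)
run-⨾ (call () t f) g μ

run-relocate-↑ʳ : ∀ {s s'} (t : Tree s' ⊥) (μ : Vec Bool s) ν →
                  run (relocate (s ↑ʳ_) t) (μ ++ ν) ≡ μ ++ run t ν
run-relocate-↑ʳ leaf μ ν = refl
run-relocate-↑ʳ (rd i t f) μ ν rewrite lookup-++ʳ μ ν i with lookup ν i
... | true  = run-relocate-↑ʳ t μ ν
... | false = run-relocate-↑ʳ f μ ν
run-relocate-↑ʳ (wr i b t) μ ν rewrite []≔-++-↑ʳ {y = b} μ ν i = run-relocate-↑ʳ t μ (ν [ i ]≔ b)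
run-relocate-↑ʳ (call () t f) μ ν

⊔-mono-≤-+ : ∀ {m n} o p q → m ≤ o + q → n ≤ p + q → m ⊔ n ≤ o ⊔ p + q
⊔-mono-≤-+ o p q m≤ n≤ = ≤-trans (⊔-mono-≤ m≤ n≤) (≤-reflexive (sym (+-distribʳ-⊔ q o p)))

⊔-mono-≤-* : ∀ {m n} o p q → m ≤ o * q → n ≤ p * q → m ⊔ n ≤ (o ⊔ p) * q
⊔-mono-≤-* o p q m≤ n≤ = ≤-trans (⊔-mono-≤ m≤ n≤) (≤-reflexive (sym (*-distribʳ-⊔ q o p)))

depth-⨾ : ∀ {s C} (t g : Tree s C) → depth (t ⨾ g) ≤ depth t + depth g
depth-⨾ leaf         g = ≤-refl
depth-⨾ (rd i t f)   g = s≤s (⊔-mono-≤-+ (depth t) (depth f) (depth g) (depth-⨾ t g) (depth-⨾ f g))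
depth-⨾ (wr i b t)   g = s≤s (depth-⨾ t g)
depth-⨾ (call u t f) g = s≤s (⊔-mono-≤-+ (depth t) (depth f) (depth g) (depth-⨾ t g) (depth-⨾ f g))

depth-relocate : ∀ {s s' C} (ι : Fin s → Fin s') (t : Tree s C) → depth (relocate ι t) ≡ depth t
depth-relocate ι leaf         = refl
depth-relocate ι (rd i t f)   = cong suc (cong₂ _⊔_ (depth-relocate ι t) (depth-relocate ι f))
depth-relocate ι (wr i b t)   = cong suc (depth-relocate ι t)
depth-relocate ι (call u t f) = cong suc (cong₂ _⊔_ (depth-relocate ι t) (depth-relocate ι f))

-- By record η, complement D is withAnswers D (λ n I → not (ans D n I)), and D is
-- both withAnswers D (ans D) and withAnswers (complement D) (ans D).
withAnswers : DynProblem → ((n : ℕ) → Bits n → Bool) → DynProblem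
withAnswers D a = record D { ans = a }

record Simulation {o o' n u e r} (flip : Bool) (M : Machine o n u e r) (N : Machine o' n u e r)
                  (_≈_ : Cfg M → Cfg N → Set) : Set where
  field
    init-≈ : ∀ I → init M I ≈ init N I
    outX-≈ : ∀ {κ κ'} → κ ≈ κ' → outX N κ' ≡ flip xor outX M κ
    outY-≈ : ∀ {κ κ'} → κ ≈ κ' → outY N κ' ≡ outY M κ
    step-≈ : ∀ c π {κ κ' κ₁} → κ ≈ κ' → stepM M c π κ ≡ just κ₁ →
             Σ[ κ₁' ∈ Cfg N ] stepM N c π κ' ≡ just κ₁' × κ₁ ≈ κ₁'
open Simulation

xor-injectiveʳ : ∀ x {y z} → x xor y ≡ x xor z → y ≡ z
xor-injectiveʳ false = λ y≡z → y≡z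
xor-injectiveʳ true  = not-injective

module _ {o o' : Maybe DynProblem} {n : ℕ} {flip : Bool} {D : DynProblem} {a : (m : ℕ) → Bits m → Bool}
         (a≡ : ∀ I → a n I ≡ flip xor ans D n I) where

  private
    D′ = withAnswers D a

    agreement-≈ : ∀ {x y} z I → (ans D n I ≡ z → x ≡ z) → y ≡ flip xor x →
                    a n I ≡ flip xor z → y ≡ flip xor z
    agreement-≈ z I ans⇒x y≡ a≡z =
      trans y≡ (cong (flip xor_) (ans⇒x (xor-injectiveʳ flip (trans (sym (a≡ I)) a≡z))))

  module _ {r} {M : Machine o n (ulen D n) 0 r} {N : Machine o' n (ulen D n) 0 r} {_≈_}
           (sim : Simulation flip M N _≈_) where

    private
      output-≈ : ∀ {I κ κ'} → κ ≈ κ' → outX M κ ≡ ans D n I → outX N κ' ≡ a n I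
      output-≈ {I} κ≈ out≡ = trans (trans (outX-≈ sim κ≈) (cong (flip xor_) out≡)) (sym (a≡ I))

    algOK-≈ : ∀ k {I κ κ'} → κ ≈ κ' → AlgOK D M I κ k → AlgOK D′ N I κ' k
    algOK-≈ zero    κ≈ ok = output-≈ κ≈ ok
    algOK-≈ (suc k) κ≈ (ok , next) = output-≈ κ≈ ok , λ c I' upd≡ →
      let (κ₁ , step≡ , ok₁) = next c I' upd≡
          (κ₁' , step≡' , κ₁≈) = step-≈ sim c [] κ≈ step≡
      in κ₁' , step≡' , algOK-≈ k κ₁≈ ok₁

  module _ {e r} {M : Machine o n (ulen D n) e r} {N : Machine o' n (ulen D n) e r} {_≈_}
           (sim : Simulation flip M N _≈_) where

    maximizing-≈ : ∀ {κ κ' c π} → κ ≈ κ' → Maximizing N κ' c π → Maximizing M κ c π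
    maximizing-≈ {c = c} {π} κ≈ max π' κ₁ κ₂ step₁ step₂ =
      let (κ₁' , step₁' , κ₁≈) = step-≈ sim c π κ≈ step₁
          (κ₂' , step₂' , κ₂≈) = step-≈ sim c π' κ≈ step₂
      in subst₂ _≤_ (outY-≈ sim κ₂≈) (outY-≈ sim κ₁≈) (max π' κ₁' κ₂' step₁' step₂')

    private
      sound-≈ : ∀ b {I κ κ'} → κ ≈ κ' → (ans D n I ≡ not b → outX M κ ≡ not b) →
                a n I ≡ not (flip xor b) → outX N κ' ≡ not (flip xor b)
      sound-≈ b {I} κ≈ sound a≡¬ =
        trans (agreement-≈ (not b) I sound (outX-≈ sim κ≈) (trans a≡¬ (not-distribʳ-xor flip b)))
              (sym (not-distribʳ-xor flip b))

      complete-≈ : ∀ b {I κ κ'} → κ ≈ κ' → (ans D n I ≡ b → outX M κ ≡ b) →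
                   a n I ≡ flip xor b → outX N κ' ≡ flip xor b
      complete-≈ b {I} κ≈ complete = agreement-≈ b I complete (outX-≈ sim κ≈)

    vSound-≈ : ∀ b k {I κ κ'} → κ ≈ κ' → VSound b D M I κ k → VSound (flip xor b) D′ N I κ' k
    vSound-≈ b zero    κ≈ sound = sound-≈ b κ≈ sound
    vSound-≈ b (suc k) κ≈ (sound , next) = sound-≈ b κ≈ sound , λ c I' upd≡ π →
      let (κ₁ , step≡ , sound₁) = next c I' upd≡ π
          (κ₁' , step≡' , κ₁≈) = step-≈ sim c π κ≈ step≡
      in κ₁' , step≡' , vSound-≈ b k κ₁≈ sound₁

    vComplete-≈ : ∀ b k {I κ κ'} → κ ≈ κ' → VSound b D M I κ k → VComplete b D M I κ k →
                  VComplete (flip xor b) D′ N I κ' k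
    vComplete-≈ b zero    κ≈ _ complete = complete-≈ b κ≈ complete
    vComplete-≈ b (suc k) κ≈ (_ , next) (complete , next') =
      complete-≈ b κ≈ complete , λ c I' upd≡ π κ₁' step≡' max →
        let (κ₁ , step≡ , sound₁) = next c I' upd≡ π
            (κ₁″ , step≡″ , κ₁≈) = step-≈ sim c π κ≈ step≡
        in subst (λ κ → VComplete (flip xor b) D′ N I' κ k) (just-injective (trans (sym step≡″) step≡'))
                 (vComplete-≈ b k κ₁≈ sound₁ (next' c I' upd≡ π κ₁ step≡ (maximizing-≈ κ≈ max)))

Solves : ∀ {o} (D : DynProblem) → ((n : ℕ) → Machine o n (ulen D n) 0 0) → Set
Solves D M = ∀ p → IsPoly p → ∀ n I → AlgOK D (M n) I (init (M n) I) (p n)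

Verifies : ∀ {o} {e r : ℕ → ℕ} (b : Bool) (D : DynProblem) →
           ((n : ℕ) → Machine o n (ulen D n) (e n) (r n)) → Set
Verifies b D M = ∀ p → IsPoly p → ∀ n I →
  VSound b D (M n) I (init (M n) I) (p n) × VComplete b D (M n) I (init (M n) I) (p n)

module _ {o o' : Maybe DynProblem} {flip : Bool} {D : DynProblem} {a : (m : ℕ) → Bits m → Bool}
         (a≡ : ∀ n I → a n I ≡ flip xor ans D n I) where

  solves-≈ : ∀ {M : (n : ℕ) → Machine o n (ulen D n) 0 0} {N : (n : ℕ) → Machine o' n (ulen D n) 0 0}
               {R : ∀ n → Cfg (M n) → Cfg (N n) → Set} →
             (∀ n → Simulation flip (M n) (N n) (R n)) → Solves D M → Solves (withAnswers D a) N
  solves-≈ sim ok p p-poly n I = algOK-≈ (a≡ n) (sim n) (p n) (init-≈ (sim n) I) (ok p p-poly n I)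

  verifies-≈ : ∀ {b} {e r : ℕ → ℕ} {M : (n : ℕ) → Machine o n (ulen D n) (e n) (r n)}
                 {N : (n : ℕ) → Machine o' n (ulen D n) (e n) (r n)}
                 {R : ∀ n → Cfg (M n) → Cfg (N n) → Set} →
               (∀ n → Simulation flip (M n) (N n) (R n)) →
               Verifies b D M → Verifies (flip xor b) (withAnswers D a) N
  verifies-≈ {b} sim ok p p-poly n I =
    let (sound , complete) = ok p p-poly n I
        init≈ = init-≈ (sim n) I
    in vSound-≈ (a≡ n) (sim n) b (p n) init≈ sound ,
       vComplete-≈ (a≡ n) (sim n) b (p n) init≈ sound complete

prependNot : ∀ {s} → Fin s → Vec Bool s → Vec Bool (suc s)
prependNot o μ = not (lookup μ o) ∷ μ

writeNot : ∀ {s} → Fin s → Tree (suc s) ⊥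
writeNot o = rd (suc o) (wr zero false leaf) (wr zero true leaf)

run-writeNot : ∀ {s} (o : Fin s) b μ → run (writeNot o) (b ∷ μ) ≡ prependNot o μ
run-writeNot o b μ with lookup μ o
... | true  = refl
... | false = refl

run-relocate-suc-⨾-writeNot : ∀ {s} (o : Fin s) t b μ →
                              run (relocate suc t ⨾ writeNot o) (b ∷ μ) ≡ prependNot o (run t μ)
run-relocate-suc-⨾-writeNot o t b μ = begin
  run (relocate suc t ⨾ writeNot o) (b ∷ μ)       ≡⟨ run-⨾ (relocate suc t) (writeNot o) (b ∷ μ) ⟩
  run (writeNot o) (run (relocate suc t) (b ∷ μ)) ≡⟨ cong (run (writeNot o)) (run-relocate-↑ʳ t (b ∷ []) μ) ⟩
  run (writeNot o) (b ∷ run t μ)                  ≡⟨ run-writeNot o b (run t μ) ⟩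
  prependNot o (run t μ)                          ∎
  where open ≡-Reasoning

negatedMachine : ∀ {n u e r} → Machine nothing n u e r → Machine nothing n u e r
negatedMachine M = record
  { mem   = suc (mem M)
  ; slice = slice M
  ; init  = λ I → prependNot (outx M) (proj₁ (init M I)) , tt
  ; tree  = λ c π → relocate suc (tree M c π) ⨾ writeNot (outx M)
  ; outx  = zero
  ; outy  = map suc (outy M)
  }

negatedMachine-simulation : ∀ {n u e r} (M : Machine nothing n u e r) →
  Simulation true M (negatedMachine M) (λ κ κ' → proj₁ κ' ≡ prependNot (outx M) (proj₁ κ))
negatedMachine-simulation M = record
  { init-≈ = λ _ → refl
  ; outX-≈ = λ { refl → refl }
  ; outY-≈ = λ { {μ , _} refl →
               cong bitsToℕ (sym (map-∘ (lookup (prependNot (outx M) μ)) suc (outy M))) }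
  ; step-≈ = step-≈′
  }
  where
  N = negatedMachine M
  step-≈′ : ∀ c π {κ κ' κ₁} → proj₁ κ' ≡ prependNot (outx M) (proj₁ κ) → stepM M c π κ ≡ just κ₁ →
            Σ[ κ₁' ∈ Cfg N ] stepM N c π κ' ≡ just κ₁' × proj₁ κ₁' ≡ prependNot (outx M) (proj₁ κ₁)
  step-≈′ c π {μ , _} refl step≡ =
    (prependNot (outx M) (run t μ) , tt) ,
    trans (exec-run (tree N c π) _)
          (cong (λ x → just (x , tt)) (run-relocate-suc-⨾-writeNot (outx M) t _ μ)) ,
    cong (prependNot (outx M) ∘ proj₁) (just-injective (trans (sym (exec-run t μ)) step≡))
    where t = tree M c π

negatedMachine-resources : ∀ {u e r : ℕ → ℕ} {M : (n : ℕ) → Machine nothing n (u n) (e n) (r n)} →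
                           Resources M → Resources (λ n → negatedMachine (M n))
negatedMachine-resources {M = M} ((T , T-polylog , depth≤T) , (S , S-poly , mem≤S) , blowUp) =
  ((λ n → T n + 2) , isPolyIn-+ T-polylog (isPolyIn-const 2) , depth≤) ,
  ((λ n → 1 + S n) , isPolyIn-+ (isPolyIn-const 1) S-poly , λ n → s≤s (mem≤S n)) ,
  blowUp
  where
  depth≤ : ∀ n c π → depth (relocate suc (tree (M n) c π) ⨾ writeNot (outx (M n))) ≤ T n + 2
  depth≤ n c π = ≤-trans (depth-⨾ (relocate suc t) _)
                         (+-monoˡ-≤ 2 (≤-trans (≤-reflexive (depth-relocate suc t)) (depth≤T n c π)))
    where t = tree (M n) c π

complementVerifier : ∀ {b D} → InVer b nothing D → InVer (not b) nothing (complement D)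
complementVerifier (e , r , e-polylog , r-polylog , M , res , ok) =
  e , r , e-polylog , r-polylog , (λ n → negatedMachine (M n)) , negatedMachine-resources {M = M} res ,
  verifies-≈ (λ _ _ → refl) (λ n → negatedMachine-simulation (M n)) ok

complementAlgorithm : ∀ {D} → Pdy (complement D) → Pdy D
complementAlgorithm (M , res , ok) =
  (λ n → negatedMachine (M n)) , negatedMachine-resources {M = M} res ,
  solves-≈ (λ _ _ → sym (not-involutive _)) (λ n → negatedMachine-simulation (M n)) ok

module OracleElimination (D' : DynProblem) (A : (m : ℕ) → Machine nothing m (ulen D' m) 0 0)
                         (A-solves : Solves D' A) where

  Tracks : ∀ {m} → Bits m → Vec Bool (mem (A m)) → Set
  Tracks {m} J ν = ∀ k → AlgOK D' (A m) J (ν , tt) k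

  tracks-init : ∀ m J → Tracks J (proj₁ (init (A m) J))
  tracks-init m J k = A-solves (λ _ → k) (isPolyIn-const k) m J

  tracks-ans : ∀ {m J ν} → Tracks {m} J ν → lookup ν (outx (A m)) ≡ ans D' m J
  tracks-ans tracks = tracks 0

  tracks-step : ∀ {m J J' ν u} → Tracks {m} J ν → upd D' m J u ≡ just J' →
                Tracks J' (run (tree (A m) u []) ν)
  tracks-step {m} {J' = J'} {ν} {u} tracks upd≡ k =
    let (κ , step≡ , ok) = proj₂ (tracks (suc k)) u J' upd≡
    in subst (λ κ → AlgOK D' (A m) J' κ k)
             (just-injective (trans (sym step≡) (exec-run (tree (A m) u []) ν))) ok

  module _ {m : ℕ} where

    -- An oracle call becomes one update of A on the second memory block followed by
    -- a branch on A's output bit, which equals the oracle's answer as long as A tracks it.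
    elimT : ∀ {s} → Tree s (OCode (just D') m) → Tree (s + mem (A m)) ⊥
    elimT         leaf         = leaf
    elimT         (rd i t f)   = rd (i ↑ˡ _) (elimT t) (elimT f)
    elimT         (wr i b t)   = wr (i ↑ˡ _) b (elimT t)
    elimT {s = s} (call u t f) =
      relocate (s ↑ʳ_) (tree (A m) u []) ⨾ rd (s ↑ʳ outx (A m)) (elimT t) (elimT f)

    run-elimT-call : ∀ {s u J J' ν} (μ : Vec Bool s) (t f : Tree s (OCode (just D') m)) →
                     upd D' m J u ≡ just J' → Tracks J ν →
                     let ν' = run (tree (A m) u []) ν in
                     run (elimT (call u t f)) (μ ++ ν) ≡
                       (if ans D' m J' then run (elimT t) (μ ++ ν') else run (elimT f) (μ ++ ν'))
    run-elimT-call {s} {u} {J' = J'} {ν} μ t f upd≡ tracks = begin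
      run (relocate (s ↑ʳ_) τ ⨾ branch) (μ ++ ν)    ≡⟨ run-⨾ (relocate (s ↑ʳ_) τ) branch (μ ++ ν) ⟩
      run branch (run (relocate (s ↑ʳ_) τ) (μ ++ ν)) ≡⟨ cong (run branch) (run-relocate-↑ʳ τ μ ν) ⟩
      run branch (μ ++ ν')                           ≡⟨ cong (λ b → if b then run (elimT t) (μ ++ ν')
                                                                            else run (elimT f) (μ ++ ν'))
                                                             answer≡ ⟩
      _                                              ∎
      where
      open ≡-Reasoning
      τ = tree (A m) u []
      ν' = run τ ν
      branch = rd (s ↑ʳ outx (A m)) (elimT t) (elimT f)
      answer≡ : lookup (μ ++ ν') (s ↑ʳ outx (A m)) ≡ ans D' m J'
      answer≡ = trans (lookup-++ʳ μ ν' (outx (A m))) (tracks-ans (tracks-step tracks upd≡))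

    run-elimT : ∀ {s} (t : Tree s (OCode (just D') m)) {μ J ν μ₁ J₁} → Tracks J ν →
                exec {just D'} t (μ , J) ≡ just (μ₁ , J₁) →
                Σ[ ν₁ ∈ Vec Bool (mem (A m)) ] run (elimT t) (μ ++ ν) ≡ μ₁ ++ ν₁ × Tracks J₁ ν₁
    run-elimT leaf tracks refl = _ , refl , tracks
    run-elimT (rd i t f) {μ} {ν = ν} tracks exec≡ rewrite lookup-++ˡ μ ν i with lookup μ i
    ... | true  = run-elimT t tracks exec≡
    ... | false = run-elimT f tracks exec≡
    run-elimT (wr i b t) {μ} {ν = ν} tracks exec≡ rewrite []≔-++-↑ˡ {x = b} μ ν i =
      run-elimT t tracks exec≡
    run-elimT (call u t f) {μ} {J} tracks exec≡ with upd D' m J u in upd≡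
    ... | nothing with () ← exec≡
    ... | just J' with ans D' m J' | run-elimT-call μ t f upd≡ tracks
    ...   | true  | run≡ = let (ν₁ , run≡₁ , tracks₁) = run-elimT t (tracks-step tracks upd≡) exec≡
                           in ν₁ , trans run≡ run≡₁ , tracks₁
    ...   | false | run≡ = let (ν₁ , run≡₁ , tracks₁) = run-elimT f (tracks-step tracks upd≡) exec≡
                           in ν₁ , trans run≡ run≡₁ , tracks₁

    depth-elimT : ∀ {s d} → (∀ u → depth (tree (A m) u []) ≤ d) →
                  (t : Tree s (OCode (just D') m)) → depth (elimT t) ≤ depth t * suc d
    depth-elimT         A≤d leaf         = z≤n
    depth-elimT {d = d} A≤d (rd i t f)   = s≤s (≤-trans branches≤ (m≤n+m _ d))
      where
      branches≤ : depth (elimT t) ⊔ depth (elimT f) ≤ (depth t ⊔ depth f) * suc d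
      branches≤ = ⊔-mono-≤-* (depth t) (depth f) (suc d) (depth-elimT A≤d t) (depth-elimT A≤d f)
    depth-elimT {d = d} A≤d (wr i b t)   = s≤s (≤-trans (depth-elimT A≤d t) (m≤n+m _ d))
    depth-elimT {s} {d} A≤d (call u t f) = begin
      depth (relocate (s ↑ʳ_) τ ⨾ branch)       ≤⟨ depth-⨾ (relocate (s ↑ʳ_) τ) branch ⟩
      depth (relocate (s ↑ʳ_) τ) + depth branch ≡⟨ cong (_+ depth branch) (depth-relocate (s ↑ʳ_) τ) ⟩
      depth τ + depth branch                    ≤⟨ +-mono-≤ (A≤d u) (s≤s branches≤) ⟩
      d + suc ((depth t ⊔ depth f) * suc d)     ≡⟨ +-suc d _ ⟩
      suc (d + (depth t ⊔ depth f) * suc d)     ∎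
      where
      open ≤-Reasoning
      τ = tree (A m) u []
      branch = rd (s ↑ʳ outx (A m)) (elimT t) (elimT f)
      branches≤ : depth (elimT t) ⊔ depth (elimT f) ≤ (depth t ⊔ depth f) * suc d
      branches≤ = ⊔-mono-≤-* (depth t) (depth f) (suc d) (depth-elimT A≤d t) (depth-elimT A≤d f)

  eliminatedMachine : ∀ {n u e r} → Machine (just D') n u e r → Machine nothing n u e r
  eliminatedMachine M = record
    { mem   = mem M + mem (A (slice M))
    ; slice = 0
    ; init  = λ I → let (μ , J) = init M I in μ ++ proj₁ (init (A (slice M)) J) , tt
    ; tree  = λ c π → elimT (tree M c π)
    ; outx  = outx M ↑ˡ _
    ; outy  = map (_↑ˡ _) (outy M)
    }

  eliminatedMachine-simulation : ∀ {n u e r} (M : Machine (just D') n u e r) →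
    Simulation false M (eliminatedMachine M)
      (λ κ κ' → Σ[ ν ∈ Vec Bool (mem (A (slice M))) ] proj₁ κ' ≡ proj₁ κ ++ ν × Tracks (proj₂ κ) ν)
  eliminatedMachine-simulation M = record
    { init-≈ = λ I → _ , refl , tracks-init (slice M) (proj₂ (init M I))
    ; outX-≈ = λ { {μ , _} (ν , refl , _) → lookup-++ˡ μ ν (outx M) }
    ; outY-≈ = λ { {μ , _} (ν , refl , _) →
                   cong bitsToℕ (trans (sym (map-∘ _ _ (outy M))) (map-cong (lookup-++ˡ μ ν) (outy M))) }
    ; step-≈ = λ { c π (ν , refl , tracks) exec≡ →
                   let (ν₁ , run≡ , tracks₁) = run-elimT (tree M c π) tracks exec≡
                   in _ , trans (exec-run (elimT (tree M c π)) _) (cong (λ x → just (x , tt)) run≡) ,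
                      ν₁ , refl , tracks₁ }
    }

  eliminatedMachine-resources : ∀ {u e r : ℕ → ℕ} {M : (n : ℕ) → Machine (just D') n (u n) (e n) (r n)} →
                                Resources A → Resources M → Resources (λ n → eliminatedMachine (M n))
  eliminatedMachine-resources {M = M}
      ((T' , T'-polylog , depthA≤T') , (S' , S'-poly , memA≤S') , _)
      ((T , T-polylog , depth≤T) , (S , S-poly , mem≤S) , (B , B-poly , slice≤B)) =
    ((λ n → T n * suc (T' (slice (M n)))) ,
     isPolyIn-* T-polylog (isPolyIn-+ (isPolyIn-const 1) (isPolylog-∘ T'-polylog slice≤B B-poly)) ,
     λ n c π → ≤-trans (depth-elimT (λ u → depthA≤T' (slice (M n)) u []) (tree (M n) c π))
                       (*-monoˡ-≤ _ (depth≤T n c π))) ,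
    ((λ n → S n + S' (slice (M n))) ,
     isPolyIn-+ S-poly (isPoly-∘ S'-poly slice≤B B-poly) ,
     λ n → +-mono-≤ (mem≤S n) (memA≤S' (slice (M n)))) ,
    ((λ _ → 0) , isPolyIn-const 0 , λ _ → z≤n)

eliminateOracle : ∀ {b D D'} → Pdy D' → InVer b (just D') D → InVer b nothing D
eliminateOracle {D' = D'} (A , A-res , A-solves) (e , r , e-polylog , r-polylog , M , res , ok) =
  e , r , e-polylog , r-polylog ,
  (λ n → eliminatedMachine (M n)) , eliminatedMachine-resources {M = M} A-res res ,
  verifies-≈ (λ _ _ → refl) (λ n → eliminatedMachine-simulation (M n)) ok
  where open OracleElimination D' A A-solves

module _ (P=NP : Pdy ≐ NPdy) where

  coNPdy⊆Pdy : ∀ {D} → InVer false nothing D → Pdy D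
  coNPdy⊆Pdy {D} v = complementAlgorithm (proj₂ (P=NP (complement D)) (complementVerifier v))

  SigmaL⊆Pdy : ∀ i {D} → SigmaL i D → Pdy D
  SigmaL⊆Pdy zero    {D} v           = proj₂ (P=NP D) v
  SigmaL⊆Pdy (suc i) {D} (_ , σ , v) = proj₂ (P=NP D) (eliminateOracle (SigmaL⊆Pdy i σ) v)

  PiL⊆Pdy : ∀ i {D} → PiL i D → Pdy D
  PiL⊆Pdy zero    v           = coNPdy⊆Pdy v
  PiL⊆Pdy (suc i) (_ , σ , v) = coNPdy⊆Pdy (eliminateOracle (SigmaL⊆Pdy i σ) v)

  PHdy⊆Pdy : ∀ {D} → PHdy D → Pdy D
  PHdy⊆Pdy (i , inj₁ σ) = SigmaL⊆Pdy i σ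
  PHdy⊆Pdy (i , inj₂ π) = PiL⊆Pdy i π

mainTheorem3 : Pdy ≐ NPdy → PHdy ≐ Pdy
mainTheorem3 P=NP D = PHdy⊆Pdy P=NP , λ p → 0 , inj₁ (proj₁ (P=NP D) p)
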